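{- Let $\mathbb U\in A[Y][t_1,\ldots,t_s]$ and let $M\geq0$ be an integer such that, for all $d$ large enough, $$\frac{\mathbb U(\theta^{q^d})}{\theta^{q^{d+M}}-\theta}\in A[t_1,\ldots,t_s].$$ Then $\mathbb U=(Y^{q^M}-\theta)\mathbb V$ for some $\mathbb V\in A[Y][t_1,\ldots,t_s]$.
   Context: $A=\mathbb F_q[\theta]$; $Y,t_1,\ldots,t_s$ are indeterminates, and $\mathbb U(\theta^{q^d})$ denotes the substitution $Y=\theta^{q^d}$. -}

module Defs where

open import Level using (Level; _⊔_)
open import Data.Nat using (ℕ; zero; suc; _+_)
open import Data.Fin using (Fin)
open import Data.List using (List; []; _∷_; map)
open import Data.Product using (Σ; _×_; _,_)
open import Data.Unit.Polymorphic using (⊤)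
open import Relation.Nullary using (¬_)
open import Relation.Binary.PropositionalEquality renaming (setoid to ≡-setoid)
open import Algebra.Bundles using (CommutativeRing)
open import Function.Bundles using (Inverse)

record Field (c ℓ : Level) : Set (Level.suc (c ⊔ ℓ)) where
  field
    commRing : CommutativeRing c ℓ
  open CommutativeRing commRing public
  field
    1≉0     : ¬ (1# ≈ 0#)
    inverse : ∀ x → ¬ (x ≈ 0#) → Σ Carrier λ y → (x * y) ≈ 1#

record FiniteField (c ℓ : Level) (q : ℕ) : Set (Level.suc (c ⊔ ℓ)) where
  field
    field′ : Field c ℓ
  open Field field′ public
  field
    enumeration : Inverse (≡-setoid (Fin q)) (Field.setoid field′)

-- Poly 0       = F
--   Poly (suc k) = (Poly k)[X_{k+1}]   as coefficient lists (constant term first)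
-- Thus Poly 1 = A = F[θ], Poly 2 = A[Y], Poly (2 + s) = A[Y][t₁,…,tₛ]
-- and Poly (1 + s) = A[t₁,…,tₛ].
module PolyOps {c ℓ} (F : Field c ℓ) where
  open Field F using (Carrier; 0#; 1#; _≈_) renaming (_+_ to _+F_; _*_ to _*F_; -_ to -F_)

  data Poly : ℕ → Set c where
    cst  : Carrier → Poly zero
    poly : ∀ {k} → List (Poly k) → Poly (suc k)

  0P : ∀ {k} → Poly k
  0P {zero}  = cst 0#
  0P {suc k} = poly []

  1P : ∀ {k} → Poly k
  1P {zero}  = cst 1#
  1P {suc k} = poly (1P ∷ [])

  infixl 6 _+P_ _-P_ _+L_
  infixl 7 _*P_ _*L_
  infix 4 _≈P_ _≈L_

  mutual
    _+P_ : ∀ {k} → Poly k → Poly k → Poly k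
    cst x  +P cst y  = cst (x +F y)
    poly xs +P poly ys = poly (xs +L ys)

    _+L_ : ∀ {k} → List (Poly k) → List (Poly k) → List (Poly k)
    [] +L ys = ys
    (x ∷ xs) +L [] = x ∷ xs
    (x ∷ xs) +L (y ∷ ys) = (x +P y) ∷ (xs +L ys)

  mutual
    -P_ : ∀ {k} → Poly k → Poly k
    -P cst x   = cst (-F x)
    -P poly xs = poly (-L xs)

    -L_ : ∀ {k} → List (Poly k) → List (Poly k)
    -L [] = []
    -L (x ∷ xs) = (-P x) ∷ (-L xs)

  _-P_ : ∀ {k} → Poly k → Poly k → Poly k
  x -P y = x +P (-P y)

  mutual
    _*P_ : ∀ {k} → Poly k → Poly k → Poly k
    cst x   *P cst y   = cst (x *F y)
    poly xs *P poly ys = poly (xs *L ys)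

    scaleL : ∀ {k} → Poly k → List (Poly k) → List (Poly k)
    scaleL x [] = []
    scaleL x (y ∷ ys) = (x *P y) ∷ scaleL x ys

    _*L_ : ∀ {k} → List (Poly k) → List (Poly k) → List (Poly k)
    [] *L ys = []
    (x ∷ xs) *L ys = scaleL x ys +L (0P ∷ (xs *L ys))

  _^P_ : ∀ {k} → Poly k → ℕ → Poly k
  p ^P zero  = 1P
  p ^P suc n = p *P (p ^P n)

  -- equality of polynomials: coefficientwise (w.r.t. the setoid equality of F),
  -- ignoring trailing zero coefficients
  mutual
    _≈P_ : ∀ {k} → Poly k → Poly k → Set ℓ
    cst x   ≈P cst y   = x ≈ y
    poly xs ≈P poly ys = xs ≈L ys

    _≈L_ : ∀ {k} → List (Poly k) → List (Poly k) → Set ℓ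
    [] ≈L [] = ⊤
    (x ∷ xs) ≈L [] = (x ≈P 0P) × (xs ≈L [])
    [] ≈L (y ∷ ys) = (0P ≈P y) × ([] ≈L ys)
    (x ∷ xs) ≈L (y ∷ ys) = (x ≈P y) × (xs ≈L ys)

  const : ∀ {k} → Poly k → Poly (suc k)
  const p = poly (p ∷ [])

  lift : ∀ {k} (s : ℕ) → Poly k → Poly (s + k)
  lift zero p    = p
  lift (suc s) p = const (lift s p)

  θ : Poly 1
  θ = poly (cst 0# ∷ cst 1# ∷ [])

  Y : Poly 2
  Y = poly (0P ∷ 1P ∷ [])

  evalYL : Poly 1 → List (Poly 1) → Poly 1
  evalYL a []       = 0P
  evalYL a (p ∷ ps) = p +P (a *P evalYL a ps)

  evalY : Poly 1 → Poly 2 → Poly 1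
  evalY a (poly ps) = evalYL a ps

  substY : (s : ℕ) → Poly 1 → Poly (s + 2) → Poly (s + 1)
  substY zero    a U = evalY a U
  substY (suc s) a (poly Us) = poly (map (substY s a) Us)

-- Divide U by the monic polynomial Y^N − θ, N = q^M: U = (Y^N − θ) Q + R with deg_Y R < N.
-- Take d so large that B = q^d exceeds the θ-degrees of the coefficients of R. Substituting
-- Y = θ^B turns Y^N − θ into θ^(BN) − θ = θ^(q^(d+M)) − θ, which therefore divides R(θ^B),
-- a polynomial of θ-degree below BN. But a multiple (θ^K − θ) z of degree below K is zero:
-- its coefficients from K on say that z is periodic, hence zero. So R(θ^B) = 0, and as the
-- coefficients of R have degree below B they sit in R(θ^B) as non-overlapping blocks, so
-- R = 0. The variables t₁ … tₛ are handled coefficient by coefficient.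

module Submission where

open import Level using (_⊔_)
open import Data.Empty using (⊥-elim)
open import Data.Fin as Fin using (Fin)
open import Data.Fin.Properties using (¬Fin0)
open import Data.List using (List; []; _∷_; _++_; length; map; take; drop)
import Data.List.Properties as List
open import Data.List.Relation.Unary.All as All using (All; []; _∷_)
open import Data.Maybe using (nothing)
open import Data.Nat using (ℕ; zero; suc; _+_; _*_; _^_; _≤_; _<_; s≤s; z≤n)
import Data.Nat.Properties as ℕ
open import Data.Product using (Σ; _×_; _,_; proj₁; proj₂; map₂)
open import Data.Unit.Polymorphic using (tt)
open import Function.Bundles using (Inverse)
open import Relation.Nullary using (Dec; yes; no)
open import Relation.Binary.Bundles using (Setoid)
open import Relation.Binary.Structures using (IsEquivalence)
open import Relation.Binary.PropositionalEquality as ≡ using (_≡_)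
import Relation.Binary.Reasoning.Setoid as SetoidReasoning
open import Algebra.Bundles using (CommutativeRing; RawRing)
open import Algebra.Structures using (IsCommutativeRing)
open import Algebra.Morphism.Structures using (IsRingMonomorphism)
import Algebra.Morphism.RingMonomorphism as RingMonomorphism
import Algebra.Consequences.Setoid as Consequences
open import Tactic.RingSolver.Core.AlmostCommutativeRing using (fromCommutativeRing)
import Tactic.RingSolver.NonReflective as RingSolver

open import Defs

n<q^n : ∀ {q} → 1 < q → ∀ n → n < q ^ n
n<q^n 1<q zero        = s≤s z≤n
n<q^n {q} 1<q (suc n) = ℕ.≤-<-trans (n<q^n 1<q n) (ℕ.^-monoʳ-< q 1<q (ℕ.n<1+n n))

module _ {c ℓ} (F : Field c ℓ) where
  open PolyOps F
  private module F = Field F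

  -- _≈P_ computes by recursion on both arguments, so Agda cannot recover
  -- them from a proof; wrapping it in a record makes them inferable.
  record _≃_ {k} (p q : Poly k) : Set ℓ where
    constructor ⟨_⟩
    field unwrap : p ≈P q
  open _≃_ public
  infix 4 _≃_

  IsPolyRing : ℕ → Set (c ⊔ ℓ)
  IsPolyRing k = IsCommutativeRing (_≃_ {k}) _+P_ _*P_ -P_ 0P 1P

  polyRawRing : ℕ → RawRing c ℓ
  polyRawRing k = record
    { Carrier = Poly k ; _≈_ = _≃_ ; _+_ = _+P_ ; _*_ = _*P_ ; -_ = -P_ ; 0# = 0P ; 1# = 1P }

  cst⁻¹ : Poly 0 → F.Carrier
  cst⁻¹ (cst x) = x

  cst⁻¹-isRingMonomorphism : IsRingMonomorphism (polyRawRing 0) F.rawRing cst⁻¹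
  cst⁻¹-isRingMonomorphism = record
    { isRingHomomorphism = record
      { isSemiringHomomorphism = record
        { isNearSemiringHomomorphism = record
          { +-isMonoidHomomorphism = record
            { isMagmaHomomorphism = record
              { isRelHomomorphism = record { cong = λ { {cst x} {cst y} → unwrap } }
              ; homo = λ { (cst x) (cst y) → F.refl } }
            ; ε-homo = F.refl }
          ; *-homo = λ { (cst x) (cst y) → F.refl } }
        ; 1#-homo = F.refl }
      ; -‿homo = λ { (cst x) → F.refl } }
    ; injective = λ { {cst x} {cst y} x≈y → ⟨ x≈y ⟩ } }

  isPolyRing₀ : IsPolyRing 0
  isPolyRing₀ = RingMonomorphism.isCommutativeRing cst⁻¹-isRingMonomorphism F.isCommutativeRing

  coeff : ∀ {k} → Poly (suc k) → ℕ → Poly k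
  coeff (poly [])       n       = 0P
  coeff (poly (x ∷ xs)) zero    = x
  coeff (poly (x ∷ xs)) (suc n) = coeff (poly xs) n

  scaleP : ∀ {k} → Poly k → Poly (suc k) → Poly (suc k)
  scaleP a (poly xs) = poly (scaleL a xs)

  shift : ∀ {k} → Poly (suc k) → Poly (suc k)
  shift (poly xs) = poly (0P ∷ xs)

  module OneMoreVariable {k} (R : IsPolyRing k) where
    private module R = IsCommutativeRing R

    coeff-cong : ∀ {p q : Poly (suc k)} → p ≃ q → ∀ n → coeff p n ≃ coeff q n
    coeff-cong {poly []}       {poly []}       _              n       = R.refl
    coeff-cong {poly (x ∷ xs)} {poly []}       ⟨ x≈0 , _ ⟩    zero    = ⟨ x≈0 ⟩
    coeff-cong {poly (x ∷ xs)} {poly []}       ⟨ _ , xs≈[] ⟩  (suc n) = coeff-cong {poly xs} {poly []} ⟨ xs≈[] ⟩ n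
    coeff-cong {poly []}       {poly (y ∷ ys)} ⟨ 0≈y , _ ⟩    zero    = ⟨ 0≈y ⟩
    coeff-cong {poly []}       {poly (y ∷ ys)} ⟨ _ , []≈ys ⟩  (suc n) = coeff-cong {poly []} {poly ys} ⟨ []≈ys ⟩ n
    coeff-cong {poly (x ∷ xs)} {poly (y ∷ ys)} ⟨ x≈y , _ ⟩    zero    = ⟨ x≈y ⟩
    coeff-cong {poly (x ∷ xs)} {poly (y ∷ ys)} ⟨ _ , xs≈ys ⟩  (suc n) = coeff-cong {poly xs} {poly ys} ⟨ xs≈ys ⟩ n

    coeff-ext : ∀ (p q : Poly (suc k)) → (∀ n → coeff p n ≃ coeff q n) → p ≃ q
    coeff-ext (poly [])       (poly [])       _ = ⟨ tt ⟩
    coeff-ext (poly (x ∷ xs)) (poly [])       h =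
      ⟨ unwrap (h 0) , unwrap (coeff-ext (poly xs) (poly []) (λ n → h (suc n))) ⟩
    coeff-ext (poly [])       (poly (y ∷ ys)) h =
      ⟨ unwrap (h 0) , unwrap (coeff-ext (poly []) (poly ys) (λ n → h (suc n))) ⟩
    coeff-ext (poly (x ∷ xs)) (poly (y ∷ ys)) h =
      ⟨ unwrap (h 0) , unwrap (coeff-ext (poly xs) (poly ys) (λ n → h (suc n))) ⟩

    ≃-isEquivalence : IsEquivalence (_≃_ {suc k})
    ≃-isEquivalence = record
      { refl  = λ {p} → coeff-ext p p (λ n → R.refl)
      ; sym   = λ {p} {q} p≃q → coeff-ext q p (λ n → R.sym (coeff-cong p≃q n))
      ; trans = λ {p} {q} {r} p≃q q≃r → coeff-ext p r (λ n → R.trans (coeff-cong p≃q n) (coeff-cong q≃r n))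
      }

    setoid : Setoid c ℓ
    setoid = record { isEquivalence = ≃-isEquivalence }
    open Setoid setoid public using (refl; sym; trans; reflexive)
    open SetoidReasoning setoid

    ∷-cong : ∀ {x y : Poly k} {xs ys} → x ≃ y → poly xs ≃ poly ys → poly (x ∷ xs) ≃ poly (y ∷ ys)
    ∷-cong ⟨ x≈y ⟩ ⟨ xs≈ys ⟩ = ⟨ x≈y , xs≈ys ⟩

    coeff-+ : ∀ (p q : Poly (suc k)) n → coeff (p +P q) n ≃ coeff p n +P coeff q n
    coeff-+ (poly [])       (poly ys)       n       = R.sym (R.+-identityˡ _)
    coeff-+ (poly (x ∷ xs)) (poly [])       n       = R.sym (R.+-identityʳ _)
    coeff-+ (poly (x ∷ xs)) (poly (y ∷ ys)) zero    = R.refl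
    coeff-+ (poly (x ∷ xs)) (poly (y ∷ ys)) (suc n) = coeff-+ (poly xs) (poly ys) n

    coeff-neg : ∀ (p : Poly (suc k)) n → coeff (-P p) n ≃ -P coeff p n
    coeff-neg (poly [])       n       = R.trans (R.sym (R.-‿inverseʳ 0P)) (R.+-identityˡ (-P 0P))
    coeff-neg (poly (x ∷ xs)) zero    = R.refl
    coeff-neg (poly (x ∷ xs)) (suc n) = coeff-neg (poly xs) n

    coeff-scale : ∀ (a : Poly k) p n → coeff (scaleP a p) n ≃ a *P coeff p n
    coeff-scale a (poly [])       n       = R.sym (R.zeroʳ a)
    coeff-scale a (poly (x ∷ xs)) zero    = R.refl
    coeff-scale a (poly (x ∷ xs)) (suc n) = coeff-scale a (poly xs) n

    +-cong : ∀ {p p′ q q′ : Poly (suc k)} → p ≃ p′ → q ≃ q′ → p +P q ≃ p′ +P q′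
    +-cong {p} {p′} {q} {q′} p≃p′ q≃q′ = coeff-ext _ _ λ n → R.trans (coeff-+ p q n)
      (R.trans (R.+-cong (coeff-cong p≃p′ n) (coeff-cong q≃q′ n)) (R.sym (coeff-+ p′ q′ n)))

    +-assoc : ∀ (p q r : Poly (suc k)) → (p +P q) +P r ≃ p +P (q +P r)
    +-assoc p q r = coeff-ext _ _ λ n → R.trans (R.trans (coeff-+ (p +P q) r n) (R.+-congʳ (coeff-+ p q n)))
      (R.trans (R.+-assoc _ _ _) (R.sym (R.trans (coeff-+ p (q +P r) n) (R.+-congˡ (coeff-+ q r n)))))

    +-comm : ∀ (p q : Poly (suc k)) → p +P q ≃ q +P p
    +-comm p q = coeff-ext _ _ λ n → R.trans (coeff-+ p q n) (R.trans (R.+-comm _ _) (R.sym (coeff-+ q p n)))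

    +-identityˡ : ∀ (p : Poly (suc k)) → 0P +P p ≃ p
    +-identityˡ (poly xs) = refl

    -‿inverseˡ : ∀ (p : Poly (suc k)) → (-P p) +P p ≃ 0P
    -‿inverseˡ p = coeff-ext _ _ λ n → R.trans (coeff-+ (-P p) p n)
      (R.trans (R.+-congʳ (coeff-neg p n)) (R.-‿inverseˡ _))

    -‿cong : ∀ {p q : Poly (suc k)} → p ≃ q → -P p ≃ -P q
    -‿cong {p} {q} p≃q = coeff-ext _ _ λ n →
      R.trans (coeff-neg p n) (R.trans (R.-‿cong (coeff-cong p≃q n)) (R.sym (coeff-neg q n)))

    +-middleFour : ∀ (p q r s : Poly (suc k)) → (p +P q) +P (r +P s) ≃ (p +P r) +P (q +P s)
    +-middleFour = Consequences.comm∧assoc⇒middleFour setoid +-cong +-comm +-assoc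

    scale-cong : ∀ {a b : Poly k} {p q} → a ≃ b → p ≃ q → scaleP a p ≃ scaleP b q
    scale-cong {a} {b} {p} {q} a≃b p≃q = coeff-ext _ _ λ n → R.trans (coeff-scale a p n)
      (R.trans (R.*-cong a≃b (coeff-cong p≃q n)) (R.sym (coeff-scale b q n)))

    scale-+ʳ : ∀ (a : Poly k) p q → scaleP a (p +P q) ≃ scaleP a p +P scaleP a q
    scale-+ʳ a p q = coeff-ext _ _ λ n →
      R.trans (R.trans (coeff-scale a (p +P q) n) (R.*-congˡ (coeff-+ p q n)))
        (R.trans (R.distribˡ _ _ _)
          (R.sym (R.trans (coeff-+ (scaleP a p) (scaleP a q) n) (R.+-cong (coeff-scale a p n) (coeff-scale a q n)))))

    scale-assoc : ∀ (a b : Poly k) p → scaleP a (scaleP b p) ≃ scaleP (a *P b) p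
    scale-assoc a b p = coeff-ext _ _ λ n → R.trans (R.trans (coeff-scale a (scaleP b p) n) (R.*-congˡ (coeff-scale b p n)))
      (R.trans (R.sym (R.*-assoc _ _ _)) (R.sym (coeff-scale (a *P b) p n)))

    scale-identity : ∀ (p : Poly (suc k)) → scaleP 1P p ≃ p
    scale-identity p = coeff-ext _ _ λ n → R.trans (coeff-scale 1P p n) (R.*-identityˡ _)

    scale-zero : ∀ (p : Poly (suc k)) → scaleP 0P p ≃ 0P
    scale-zero p = coeff-ext _ _ λ n → R.trans (coeff-scale 0P p n) (R.zeroˡ _)

    shift-cong : ∀ {p q : Poly (suc k)} → p ≃ q → shift p ≃ shift q
    shift-cong {poly _} {poly _} p≃q = ∷-cong R.refl p≃q

    shift-+ : ∀ (p q : Poly (suc k)) → shift (p +P q) ≃ shift p +P shift q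
    shift-+ (poly _) (poly _) = ∷-cong (R.sym (R.+-identityˡ 0P)) refl

    shift-scale : ∀ (a : Poly k) p → shift (scaleP a p) ≃ scaleP a (shift p)
    shift-scale a (poly _) = ∷-cong (R.sym (R.zeroʳ a)) refl

    shift-zero : shift 0P ≃ 0P {suc k}
    shift-zero = ⟨ unwrap (R.refl {0P}) , tt ⟩

    +-identityʳ : ∀ (p : Poly (suc k)) → p +P 0P ≃ p
    +-identityʳ = Consequences.comm∧idˡ⇒idʳ setoid +-comm +-identityˡ

    poly-∷ : ∀ (a : Poly k) as → poly (a ∷ as) ≃ const a +P shift (poly as)
    poly-∷ a as = ∷-cong (R.sym (R.+-identityʳ a)) refl

    *-congʳ : ∀ (p : Poly (suc k)) {q q′} → q ≃ q′ → p *P q ≃ p *P q′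
    *-congʳ (poly [])       {poly _} {poly _} _    = refl
    *-congʳ (poly (a ∷ as)) {poly _} {poly _} q≃q′ =
      +-cong (scale-cong R.refl q≃q′) (shift-cong (*-congʳ (poly as) q≃q′))

    *-distribˡ-+ : ∀ (p q r : Poly (suc k)) → p *P (q +P r) ≃ p *P q +P p *P r
    *-distribˡ-+ (poly [])       (poly _)    (poly _)    = refl
    *-distribˡ-+ (poly (a ∷ as)) q@(poly _) r@(poly _) = begin
      scaleP a (q +P r) +P shift (poly as *P (q +P r))
        ≈⟨ +-cong (scale-+ʳ a q r)
                  (trans (shift-cong (*-distribˡ-+ (poly as) q r)) (shift-+ (poly as *P q) (poly as *P r))) ⟩
      (scaleP a q +P scaleP a r) +P (shift (poly as *P q) +P shift (poly as *P r))
        ≈⟨ +-middleFour (scaleP a q) (scaleP a r) (shift (poly as *P q)) (shift (poly as *P r)) ⟩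
      (scaleP a q +P shift (poly as *P q)) +P (scaleP a r +P shift (poly as *P r)) ∎

    *-shiftʳ : ∀ (p q : Poly (suc k)) → p *P shift q ≃ shift (p *P q)
    *-shiftʳ (poly [])       (poly _)   = sym shift-zero
    *-shiftʳ (poly (a ∷ as)) q@(poly _) = begin
      scaleP a (shift q) +P shift (poly as *P shift q)
        ≈⟨ +-cong (sym (shift-scale a q)) (shift-cong (*-shiftʳ (poly as) q)) ⟩
      shift (scaleP a q) +P shift (shift (poly as *P q)) ≈⟨ shift-+ (scaleP a q) (shift (poly as *P q)) ⟨
      shift (scaleP a q +P shift (poly as *P q))         ∎

    *-shiftˡ : ∀ (p q : Poly (suc k)) → shift p *P q ≃ shift (p *P q)
    *-shiftˡ p@(poly _) q@(poly _) = trans (+-cong (scale-zero q) refl) (+-identityˡ (shift (p *P q)))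

    *-constʳ : ∀ p (b : Poly k) → p *P const b ≃ scaleP b p
    *-constʳ (poly [])       b = refl
    *-constʳ (poly (a ∷ as)) b = ∷-cong (R.trans (R.+-identityʳ _) (R.*-comm a b)) (*-constʳ (poly as) b)

    *-scaleˡ : ∀ (a : Poly k) p q → scaleP a p *P q ≃ scaleP a (p *P q)
    *-scaleˡ a (poly [])       (poly _)   = refl
    *-scaleˡ a (poly (b ∷ bs)) q@(poly _) = begin
      scaleP (a *P b) q +P shift (scaleP a (poly bs) *P q)
        ≈⟨ +-cong (sym (scale-assoc a b q)) (trans (shift-cong (*-scaleˡ a (poly bs) q)) (shift-scale a (poly bs *P q))) ⟩
      scaleP a (scaleP b q) +P scaleP a (shift (poly bs *P q)) ≈⟨ scale-+ʳ a (scaleP b q) (shift (poly bs *P q)) ⟨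
      scaleP a (scaleP b q +P shift (poly bs *P q))            ∎

    *-zeroʳ : ∀ (p : Poly (suc k)) → p *P 0P ≃ 0P
    *-zeroʳ (poly [])       = refl
    *-zeroʳ (poly (a ∷ as)) = trans (shift-cong (*-zeroʳ (poly as))) shift-zero

    *-comm : ∀ (p q : Poly (suc k)) → p *P q ≃ q *P p
    *-comm (poly [])       q@(poly _) = sym (*-zeroʳ q)
    *-comm (poly (a ∷ as)) q@(poly _) = begin
      scaleP a q +P shift (poly as *P q)   ≈⟨ +-cong (sym (*-constʳ q a)) (shift-cong (*-comm (poly as) q)) ⟩
      q *P const a +P shift (q *P poly as) ≈⟨ +-cong refl (sym (*-shiftʳ q (poly as))) ⟩
      q *P const a +P q *P shift (poly as) ≈⟨ *-distribˡ-+ q (const a) (shift (poly as)) ⟨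
      q *P (const a +P shift (poly as))    ≈⟨ *-congʳ q (poly-∷ a as) ⟨
      q *P poly (a ∷ as)                   ∎

    *-distribʳ-+ : ∀ (p q r : Poly (suc k)) → (q +P r) *P p ≃ q *P p +P r *P p
    *-distribʳ-+ = Consequences.comm∧distrˡ⇒distrʳ setoid +-cong *-comm *-distribˡ-+

    *-assoc : ∀ (p q r : Poly (suc k)) → (p *P q) *P r ≃ p *P (q *P r)
    *-assoc (poly [])       (poly _)   (poly _)   = refl
    *-assoc (poly (a ∷ as)) q@(poly _) r@(poly _) = begin
      (scaleP a q +P shift (poly as *P q)) *P r   ≈⟨ *-distribʳ-+ r (scaleP a q) (shift (poly as *P q)) ⟩
      scaleP a q *P r +P shift (poly as *P q) *P r
        ≈⟨ +-cong (*-scaleˡ a q r) (trans (*-shiftˡ (poly as *P q) r) (shift-cong (*-assoc (poly as) q r))) ⟩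
      scaleP a (q *P r) +P shift (poly as *P (q *P r)) ∎

    *-cong : ∀ {p p′ q q′ : Poly (suc k)} → p ≃ p′ → q ≃ q′ → p *P q ≃ p′ *P q′
    *-cong {p} {p′} {q} {q′} p≃p′ q≃q′ =
      trans (*-congʳ p q≃q′) (trans (*-comm p q′) (trans (*-congʳ q′ p≃p′) (*-comm q′ p′)))

    *-identityˡ : ∀ (p : Poly (suc k)) → 1P *P p ≃ p
    *-identityˡ p@(poly _) = trans (+-cong (scale-identity p) shift-zero) (+-identityʳ p)

    isPolyRing-suc : IsPolyRing (suc k)
    isPolyRing-suc = record
      { isRing = record
        { +-isAbelianGroup = record
          { isGroup = record
            { isMonoid = record
              { isSemigroup = record
                { isMagma = record { isEquivalence = ≃-isEquivalence ; ∙-cong = +-cong }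
                ; assoc = +-assoc }
              ; identity = +-identityˡ , +-identityʳ }
            ; inverse = Consequences.comm∧invˡ⇒inv setoid +-comm -‿inverseˡ
            ; ⁻¹-cong = -‿cong }
          ; comm = +-comm }
        ; *-cong = *-cong
        ; *-assoc = *-assoc
        ; *-identity = Consequences.comm∧idˡ⇒id setoid *-comm *-identityˡ
        ; distrib = *-distribˡ-+ , *-distribʳ-+ }
      ; *-comm = *-comm }

  isPolyRing : ∀ k → IsPolyRing k
  isPolyRing zero    = isPolyRing₀
  isPolyRing (suc k) = OneMoreVariable.isPolyRing-suc (isPolyRing k)

  PolyRing : ℕ → CommutativeRing c ℓ
  PolyRing k = record { isCommutativeRing = isPolyRing k }

  _∣_ : ∀ {k} → Poly k → Poly k → Set (c ⊔ ℓ)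
  _∣_ {k} p q = Σ (Poly k) λ w → q ≃ p *P w

  X : ∀ {k} → Poly (suc k)
  X = poly (0P ∷ 1P ∷ [])

  DegreeBelow : ∀ {k} → ℕ → Poly (suc k) → Set ℓ
  DegreeBelow n p = ∀ i → n ≤ i → coeff p i ≃ 0P

  coeff-map : ∀ {j k} (f : Poly j → Poly k) → f 0P ≡ 0P →
              ∀ xs i → coeff (poly (map f xs)) i ≡ f (coeff (poly xs) i)
  coeff-map f f0≡0 []       i       = ≡.sym f0≡0
  coeff-map f f0≡0 (x ∷ xs) zero    = ≡.refl
  coeff-map f f0≡0 (x ∷ xs) (suc i) = coeff-map f f0≡0 xs i

  All-by-coeff : ∀ {k p} {P : Poly k → Set p} xs → (∀ i → P (coeff (poly xs) i)) → All P xs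
  All-by-coeff []       _ = []
  All-by-coeff (x ∷ xs) h = h 0 ∷ All-by-coeff xs (λ i → h (suc i))

  module Univariate (k : ℕ) where
    open OneMoreVariable (isPolyRing k) public
    private module R = CommutativeRing (PolyRing k)
    open SetoidReasoning setoid

    coeff-shift-zero : ∀ (p : Poly (suc k)) → coeff (shift p) 0 ≃ 0P
    coeff-shift-zero (poly _) = R.refl

    coeff-shift-suc : ∀ (p : Poly (suc k)) i → coeff (shift p) (suc i) ≃ coeff p i
    coeff-shift-suc (poly _) i = R.refl

    X*≃shift : ∀ (p : Poly (suc k)) → X *P p ≃ shift p
    X*≃shift p@(poly _) = trans (+-cong (scale-zero p) (shift-cong (*-identityˡ p))) (+-identityˡ (shift p))

    X^suc*≃shift : ∀ n (p : Poly (suc k)) → X ^P suc n *P p ≃ shift (X ^P n *P p)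
    X^suc*≃shift n p = trans (*-assoc X (X ^P n) p) (X*≃shift (X ^P n *P p))

    coeff-X^* : ∀ n (p : Poly (suc k)) m → coeff (X ^P n *P p) (n + m) ≃ coeff p m
    coeff-X^* zero    p m = coeff-cong (*-identityˡ p) m
    coeff-X^* (suc n) p m = R.trans (coeff-cong (X^suc*≃shift n p) (suc (n + m)))
      (R.trans (coeff-shift-suc (X ^P n *P p) (n + m)) (coeff-X^* n p m))

    coeff-X^*-< : ∀ n (p : Poly (suc k)) {i} → i < n → coeff (X ^P n *P p) i ≃ 0P
    coeff-X^*-< (suc n) p {zero}  _         = R.trans (coeff-cong (X^suc*≃shift n p) 0) (coeff-shift-zero (X ^P n *P p))
    coeff-X^*-< (suc n) p {suc i} (s≤s i<n) = R.trans (coeff-cong (X^suc*≃shift n p) (suc i))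
      (R.trans (coeff-shift-suc (X ^P n *P p) i) (coeff-X^*-< n p i<n))

    poly-++ : ∀ lo hi → poly (lo ++ hi) ≃ poly lo +P X ^P length lo *P poly hi
    poly-++ []       hi = sym (trans (+-identityˡ (1P *P poly hi)) (*-identityˡ (poly hi)))
    poly-++ (a ∷ lo) hi = begin
      poly (a ∷ (lo ++ hi))                                        ≈⟨ poly-∷ a (lo ++ hi) ⟩
      const a +P shift (poly (lo ++ hi))                           ≈⟨ +-cong refl (shift-cong (poly-++ lo hi)) ⟩
      const a +P shift (poly lo +P X ^P length lo *P poly hi)      ≈⟨ +-cong refl (shift-+ (poly lo) _) ⟩
      const a +P (shift (poly lo) +P shift (X ^P length lo *P poly hi))
        ≈⟨ +-cong refl (+-cong refl (sym (X^suc*≃shift (length lo) (poly hi)))) ⟩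
      const a +P (shift (poly lo) +P X ^P suc (length lo) *P poly hi) ≈⟨ +-assoc (const a) _ _ ⟨
      (const a +P shift (poly lo)) +P X ^P suc (length lo) *P poly hi ≈⟨ +-cong (poly-∷ a lo) refl ⟨
      poly (a ∷ lo) +P X ^P length (a ∷ lo) *P poly hi             ∎

    degreeBelow-cong : ∀ {n} {p q : Poly (suc k)} → p ≃ q → DegreeBelow n p → DegreeBelow n q
    degreeBelow-cong p≃q p<n i n≤i = R.trans (R.sym (coeff-cong p≃q i)) (p<n i n≤i)

    degreeBelow-mono : ∀ {m n} {p : Poly (suc k)} → m ≤ n → DegreeBelow m p → DegreeBelow n p
    degreeBelow-mono m≤n p<m i n≤i = p<m i (ℕ.≤-trans m≤n n≤i)

    degreeBelow-length : ∀ xs → DegreeBelow (length xs) (poly xs)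
    degreeBelow-length []       i       _         = R.refl
    degreeBelow-length (x ∷ xs) (suc i) (s≤s n≤i) = degreeBelow-length xs i n≤i

    commonDegreeBound : ∀ (ps : List (Poly (suc k))) → Σ ℕ λ L → ∀ {n} → L ≤ n → All (DegreeBelow n) ps
    commonDegreeBound []              = 0 , λ _ → []
    commonDegreeBound (poly xs ∷ ps) with commonDegreeBound ps
    ... | L , ps<L = length xs + L , λ le →
      degreeBelow-mono {p = poly xs} (ℕ.m+n≤o⇒m≤o (length xs) le) (degreeBelow-length xs)
        ∷ ps<L (ℕ.m+n≤o⇒n≤o (length xs) le)

    periodic⇒zero : ∀ t (p : Poly (suc k)) → (∀ j → coeff p j ≃ coeff p (suc t + j)) → p ≃ 0P
    periodic⇒zero t p@(poly xs) periodic = coeff-ext p 0P λ j →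
      R.trans (iterate (length xs) j)
        (degreeBelow-length xs _ (ℕ.≤-trans (ℕ.m≤m*n (length xs) (suc t)) (ℕ.m≤m+n _ j)))
      where
      iterate : ∀ n j → coeff p j ≃ coeff p (n * suc t + j)
      iterate zero    j = R.refl
      iterate (suc n) j = R.trans (iterate n j)
        (R.trans (periodic (n * suc t + j)) (R.reflexive (≡.cong (coeff p) (≡.sym (ℕ.+-assoc (suc t) (n * suc t) j)))))

    length-scaleL : ∀ (a : Poly k) xs → length (scaleL a xs) ≡ length xs
    length-scaleL a []       = ≡.refl
    length-scaleL a (x ∷ xs) = ≡.cong suc (length-scaleL a xs)

    length-+L-≤ : ∀ {n} (xs ys : List (Poly k)) → length xs ≤ n → length ys ≤ n → length (xs +L ys) ≤ n
    length-+L-≤ []       ys       _         ys≤n      = ys≤n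
    length-+L-≤ (x ∷ xs) []       xs≤n      _         = xs≤n
    length-+L-≤ (x ∷ xs) (y ∷ ys) (s≤s xs≤n) (s≤s ys≤n) = s≤s (length-+L-≤ xs ys xs≤n ys≤n)

    const-*≃scale : ∀ (a : Poly k) p → const a *P p ≃ scaleP a p
    const-*≃scale a p = trans (*-comm (const a) p) (*-constʳ p a)

    const-∣⇒∣-coeff : ∀ {a : Poly k} {p} → const a ∣ p → ∀ i → a ∣ coeff p i
    const-∣⇒∣-coeff {a} {p} (w , p≃aw) i = coeff w i ,
      R.trans (coeff-cong (trans p≃aw (const-*≃scale a w)) i) (coeff-scale a w i)

    All-∣⇒const-∣ : ∀ {a : Poly k} {xs} → All (a ∣_) xs → const a ∣ poly xs
    All-∣⇒const-∣ {a} []                       = 0P , sym (*-zeroʳ (const a))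
    All-∣⇒const-∣ {a} ((w , x≃aw) ∷ xs∣) with All-∣⇒const-∣ xs∣
    ... | poly ws , xs≃aws = poly (w ∷ ws) ,
      trans (∷-cong x≃aw (trans xs≃aws (const-*≃scale a (poly ws)))) (sym (const-*≃scale a (poly (w ∷ ws))))

  module Division {k} (N : ℕ) (1≤N : 1 ≤ N) (a : Poly k) where
    open Univariate k
    private module S = RingSolver (fromCommutativeRing (PolyRing (suc k)) (λ _ → nothing))
    open S using (_⊕_; _⊗_; _⊜_)
    open import Algebra.Properties.Group (CommutativeRing.+-group (PolyRing (suc k))) using (//-rightDividesˡ)
    open SetoidReasoning setoid

    E : Poly (suc k)
    E = X ^P N -P const a

    record DivisionWithRemainder (p : Poly (suc k)) : Set (c ⊔ ℓ) where
      field
        quotient         : Poly (suc k)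
        remainder        : List (Poly k)
        remainder-length : length remainder ≤ N
        equation         : p ≃ E *P quotient +P poly remainder

    poly-++-reduce : ∀ lo hi → length lo ≡ N → poly (lo ++ hi) ≃ E *P poly hi +P poly (lo +L scaleL a hi)
    poly-++-reduce lo hi ≡.refl = begin
      poly (lo ++ hi)                                  ≈⟨ poly-++ lo hi ⟩
      poly lo +P X ^P N *P poly hi
        ≈⟨ +-cong refl (*-cong (sym (//-rightDividesˡ (const a) (X ^P N))) refl) ⟩
      poly lo +P (E +P const a) *P poly hi             ≈⟨ rearrange (poly lo) E (const a) (poly hi) ⟩
      E *P poly hi +P (poly lo +P const a *P poly hi)  ≈⟨ +-cong refl (+-cong refl (const-*≃scale a (poly hi))) ⟩
      E *P poly hi +P poly (lo +L scaleL a hi)         ∎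
      where
      rearrange : ∀ l e t h → l +P (e +P t) *P h ≃ e *P h +P (l +P t *P h)
      rearrange = S.solve 4 (λ l e t h → (l ⊕ ((e ⊕ t) ⊗ h)) ⊜ ((e ⊗ h) ⊕ (l ⊕ (t ⊗ h)))) refl

    reduceOnce : ∀ us → length us ≤ suc N → DivisionWithRemainder (poly us)
    reduceOnce us _ with length us ℕ.≤? N
    ... | yes us≤N = record
      { quotient = 0P ; remainder = us ; remainder-length = us≤N
      ; equation = sym (trans (+-cong (*-zeroʳ E) refl) (+-identityˡ (poly us))) }
    reduceOnce us us≤1+N | no us≰N = record
      { quotient = poly hi ; remainder = lo +L scaleL a hi
      ; remainder-length = length-+L-≤ lo (scaleL a hi) (ℕ.≤-reflexive length-lo)
          (ℕ.≤-trans (ℕ.≤-reflexive (length-scaleL a hi)) (ℕ.≤-trans length-hi 1≤N))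
      ; equation = trans (reflexive (≡.cong poly (≡.sym (List.take++drop≡id N us)))) (poly-++-reduce lo hi length-lo) }
      where
      lo = take N us
      hi = drop N us
      length-lo : length lo ≡ N
      length-lo = ≡.trans (List.length-take N us) (ℕ.m≤n⇒m⊓n≡m (ℕ.<⇒≤ (ℕ.≰⇒> us≰N)))
      length-hi : length hi ≤ 1
      length-hi = ℕ.≤-trans (ℕ.≤-reflexive (List.length-drop N us))
        (ℕ.≤-trans (ℕ.∸-monoˡ-≤ N us≤1+N) (ℕ.≤-reflexive (ℕ.m+n∸n≡m 1 N)))

    divide : ∀ p → DivisionWithRemainder p
    divide (poly [])       = record
      { quotient = 0P ; remainder = [] ; remainder-length = z≤n
      ; equation = sym (trans (+-cong (*-zeroʳ E) refl) (+-identityˡ 0P)) }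
    divide (poly (u ∷ us)) = record
      { quotient = X *P q +P q′ ; remainder = rs′ ; remainder-length = rs′≤N
      ; equation = begin
        poly (u ∷ us)                                ≈⟨ poly-∷ u us ⟩
        const u +P shift (poly us)                   ≈⟨ +-cong refl (trans (shift-cong us≃) (sym (X*≃shift _))) ⟩
        const u +P X *P (E *P q +P poly rs)          ≈⟨ pull-E (const u) X E q (poly rs) ⟩
        E *P (X *P q) +P (const u +P X *P poly rs)
          ≈⟨ +-cong refl (trans (+-cong (refl {const u}) (X*≃shift (poly rs))) (sym (poly-∷ u rs))) ⟩
        E *P (X *P q) +P poly (u ∷ rs)               ≈⟨ +-cong refl u∷rs≃ ⟩
        E *P (X *P q) +P (E *P q′ +P poly rs′)       ≈⟨ collect-E E (X *P q) q′ (poly rs′) ⟩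
        E *P (X *P q +P q′) +P poly rs′              ∎ }
      where
      open DivisionWithRemainder (divide (poly us))
        renaming (quotient to q; remainder to rs; remainder-length to rs≤N; equation to us≃)
      open DivisionWithRemainder (reduceOnce (u ∷ rs) (s≤s rs≤N))
        renaming (quotient to q′; remainder to rs′; remainder-length to rs′≤N; equation to u∷rs≃)
      pull-E : ∀ v x e q r → v +P x *P (e *P q +P r) ≃ e *P (x *P q) +P (v +P x *P r)
      pull-E = S.solve 5 (λ v x e q r → (v ⊕ (x ⊗ ((e ⊗ q) ⊕ r))) ⊜ ((e ⊗ (x ⊗ q)) ⊕ (v ⊕ (x ⊗ r)))) refl
      collect-E : ∀ e q q′ r → e *P q +P (e *P q′ +P r) ≃ e *P (q +P q′) +P r
      collect-E = S.solve 4 (λ e q q′ r → ((e ⊗ q) ⊕ ((e ⊗ q′) ⊕ r)) ⊜ ((e ⊗ (q ⊕ q′)) ⊕ r)) refl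

  ∣-remainder : ∀ {k} {d x e r : Poly k} → d ∣ x → x ≃ d *P e +P r → d ∣ r
  ∣-remainder {k} {d} {x} {e} {r} (w , x≃dw) x≃de+r = w -P e , (begin
    r                        ≈⟨ xyx⁻¹≈y (d *P e) r ⟨
    d *P e +P r -P d *P e    ≈⟨ +-congʳ (sym x≃de+r) ⟩
    x -P d *P e              ≈⟨ +-congʳ x≃dw ⟩
    d *P w -P d *P e         ≈⟨ +-congˡ (-‿distribʳ-* d e) ⟩
    d *P w +P d *P (-P e)    ≈⟨ distribˡ d w (-P e) ⟨
    d *P (w -P e)            ∎)
    where
    open CommutativeRing (PolyRing k)
    open import Algebra.Properties.AbelianGroup (+-abelianGroup) using (xyx⁻¹≈y)
    open import Algebra.Properties.Ring ring using (-‿distribʳ-*)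
    open SetoidReasoning setoid

  module Evaluation (a : Poly 1) where
    private module A = CommutativeRing (PolyRing 1)
    private module S = RingSolver (fromCommutativeRing (PolyRing 1) (λ _ → nothing))
    open S using (_⊕_; _⊗_; _⊜_)

    evalYL-cong : ∀ xs ys → xs ≈L ys → evalYL a xs ≃ evalYL a ys
    evalYL-cong []       []       _              = A.refl
    evalYL-cong (x ∷ xs) []       (x≈0 , xs≈[])  =
      A.trans (A.+-cong ⟨ x≈0 ⟩ (A.*-congˡ (evalYL-cong xs [] xs≈[]))) (A.trans (A.+-identityˡ _) (A.zeroʳ a))
    evalYL-cong []       (y ∷ ys) (0≈y , []≈ys)  = A.sym
      (A.trans (A.+-cong (A.sym ⟨ 0≈y ⟩) (A.*-congˡ (A.sym (evalYL-cong [] ys []≈ys))))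
        (A.trans (A.+-identityˡ _) (A.zeroʳ a)))
    evalYL-cong (x ∷ xs) (y ∷ ys) (x≈y , xs≈ys) = A.+-cong ⟨ x≈y ⟩ (A.*-congˡ (evalYL-cong xs ys xs≈ys))

    evalY-cong : ∀ {U V : Poly 2} → U ≃ V → evalY a U ≃ evalY a V
    evalY-cong {poly xs} {poly ys} ⟨ xs≈ys ⟩ = evalYL-cong xs ys xs≈ys

    evalY-+ : ∀ (U V : Poly 2) → evalY a (U +P V) ≃ evalY a U +P evalY a V
    evalY-+ (poly [])       (poly ys)       = A.sym (A.+-identityˡ _)
    evalY-+ (poly (x ∷ xs)) (poly [])       = A.sym (A.+-identityʳ _)
    evalY-+ (poly (x ∷ xs)) (poly (y ∷ ys)) =
      A.trans (A.+-congˡ (A.*-congˡ (evalY-+ (poly xs) (poly ys)))) (interchange x y (evalYL a xs) (evalYL a ys) a)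
      where
      interchange : ∀ x y u v t → (x +P y) +P t *P (u +P v) ≃ (x +P t *P u) +P (y +P t *P v)
      interchange = S.solve 5
        (λ x y u v t → ((x ⊕ y) ⊕ (t ⊗ (u ⊕ v))) ⊜ ((x ⊕ (t ⊗ u)) ⊕ (y ⊕ (t ⊗ v)))) A.refl

    evalY-scale : ∀ x (U : Poly 2) → evalY a (scaleP x U) ≃ x *P evalY a U
    evalY-scale x (poly [])       = A.sym (A.zeroʳ x)
    evalY-scale x (poly (y ∷ ys)) =
      A.trans (A.+-congˡ (A.*-congˡ (evalY-scale x (poly ys)))) (factor a x y (evalYL a ys))
      where
      -- The solver's two normal forms agree definitionally only with t listed first.
      factor : ∀ t x y u → x *P y +P t *P (x *P u) ≃ x *P (y +P t *P u)
      factor = S.solve 4 (λ t x y u → ((x ⊗ y) ⊕ (t ⊗ (x ⊗ u))) ⊜ (x ⊗ (y ⊕ (t ⊗ u)))) A.refl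

    evalY-* : ∀ (U V : Poly 2) → evalY a (U *P V) ≃ evalY a U *P evalY a V
    evalY-* (poly [])       (poly _) = A.sym (A.zeroˡ _)
    evalY-* (poly (x ∷ xs)) V@(poly _) = begin
      evalY a (scaleP x V +P shift (poly xs *P V))          ≈⟨ evalY-+ (scaleP x V) (shift (poly xs *P V)) ⟩
      evalY a (scaleP x V) +P (0P +P a *P evalY a (poly xs *P V))
        ≈⟨ A.+-cong (evalY-scale x V) (A.trans (A.+-identityˡ _) (A.*-congˡ (evalY-* (poly xs) V))) ⟩
      x *P evalY a V +P a *P (evalYL a xs *P evalY a V)      ≈⟨ A.+-congˡ (A.*-assoc a _ _) ⟨
      x *P evalY a V +P (a *P evalYL a xs) *P evalY a V      ≈⟨ A.distribʳ (evalY a V) x _ ⟨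
      (x +P a *P evalYL a xs) *P evalY a V                   ∎
      where open SetoidReasoning A.setoid

    evalY-const : ∀ p → evalY a (const p) ≃ p
    evalY-const p = A.trans (A.+-congˡ (A.zeroʳ a)) (A.+-identityʳ p)

    evalY-Y : evalY a Y ≃ a
    evalY-Y = A.trans (A.+-identityˡ _) (A.trans (A.*-congˡ (evalY-const 1P)) (A.*-identityʳ a))

    evalY-Y^ : ∀ n → evalY a (Y ^P n) ≃ a ^P n
    evalY-Y^ zero    = evalY-const 1P
    evalY-Y^ (suc n) = A.trans (evalY-* Y (Y ^P n)) (A.*-cong evalY-Y (evalY-Y^ n))

  module ThetaAdic where
    open Univariate 0
    private module A = CommutativeRing (PolyRing 1)
    private module K = CommutativeRing (PolyRing 0)
    open import Algebra.Properties.Group K.+-group using (x∙y⁻¹≈ε⇒x≈y)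
    open import Algebra.Properties.Ring A.ring using (-‿distribˡ-*)
    open import Algebra.Properties.Semiring.Exp A.semiring using (^-assocʳ) renaming (_^_ to _^ᴬ_)

    ^P≡^ : ∀ (x : Poly 1) n → x ^P n ≡ x ^ᴬ n
    ^P≡^ x zero    = ≡.refl
    ^P≡^ x (suc n) = ≡.cong (x *P_) (^P≡^ x n)

    ^P-assocʳ : ∀ (x : Poly 1) m n → (x ^P m) ^P n ≃ x ^P (m * n)
    ^P-assocʳ x m n = A.trans (A.reflexive (≡.trans (^P≡^ (x ^P m) n) (≡.cong (_^ᴬ n) (^P≡^ x m))))
      (A.trans (^-assocʳ x m n) (A.reflexive (≡.sym (^P≡^ x (m * n)))))

    θ^K-θ-multiple-degree<K⇒zero : ∀ {K} → 2 ≤ K → ∀ z → DegreeBelow K ((θ ^P K -P θ) *P z) → z ≃ 0P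
    θ^K-θ-multiple-degree<K⇒zero {K@(suc (suc t))} (s≤s (s≤s _)) z low = periodic⇒zero t z λ j →
      x∙y⁻¹≈ε⇒x≈y (coeff z j) (coeff z (suc t + j)) (K.trans (K.sym (coeff-at-K+ j)) (low (K + j) (ℕ.m≤m+n K j)))
      where
      coeff-at-K+ : ∀ j → coeff ((θ ^P K -P θ) *P z) (K + j) ≃ coeff z j -P coeff z (suc t + j)
      coeff-at-K+ j = begin
        coeff ((θ ^P K -P θ) *P z) (K + j)
          ≈⟨ coeff-cong (A.trans (A.distribʳ z (θ ^P K) (-P θ)) (A.+-congˡ (A.sym (-‿distribˡ-* θ z)))) (K + j) ⟩
        coeff (θ ^P K *P z -P θ *P z) (K + j)
          ≈⟨ coeff-+ (θ ^P K *P z) (-P (θ *P z)) (K + j) ⟩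
        coeff (θ ^P K *P z) (K + j) +P coeff (-P (θ *P z)) (K + j)
          ≈⟨ K.+-cong (coeff-X^* K z j) (coeff-neg (θ *P z) (K + j)) ⟩
        coeff z j -P coeff (θ *P z) (K + j)
          ≈⟨ K.+-congˡ (K.-‿cong (K.trans (coeff-cong (X*≃shift z) (K + j)) (coeff-shift-suc z (suc t + j)))) ⟩
        coeff z j -P coeff z (suc t + j)
          ∎
        where open SetoidReasoning K.setoid

    module Digits (B : ℕ) where
      open Evaluation (θ ^P B) using (evalY-+; evalY-Y^; evalY-const)

      evalY-Y^N-θ : ∀ N → evalY (θ ^P B) (Y ^P N -P const θ) ≃ θ ^P (B * N) -P θ
      evalY-Y^N-θ N = A.trans (evalY-+ (Y ^P N) (-P const θ))
        (A.+-cong (A.trans (evalY-Y^ N) (^P-assocʳ θ B N)) (evalY-const (-P θ)))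

      coeff-evalYL-+B : ∀ r rs → DegreeBelow B r → ∀ m →
                        coeff (evalYL (θ ^P B) (r ∷ rs)) (B + m) ≃ coeff (evalYL (θ ^P B) rs) m
      coeff-evalYL-+B r rs r<B m = K.trans (coeff-+ r (θ ^P B *P evalYL (θ ^P B) rs) (B + m))
        (K.trans (K.+-cong (r<B (B + m) (ℕ.m≤m+n B m)) (coeff-X^* B (evalYL (θ ^P B) rs) m)) (K.+-identityˡ _))

      coeff-evalYL-<B : ∀ r rs {i} → i < B → coeff (evalYL (θ ^P B) (r ∷ rs)) i ≃ coeff r i
      coeff-evalYL-<B r rs i<B = K.trans (coeff-+ r (θ ^P B *P evalYL (θ ^P B) rs) _)
        (K.trans (K.+-congˡ (coeff-X^*-< B (evalYL (θ ^P B) rs) i<B)) (K.+-identityʳ _))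

      evalYL-degreeBelow : ∀ rs → All (DegreeBelow B) rs → DegreeBelow (length rs * B) (evalYL (θ ^P B) rs)
      evalYL-degreeBelow []       []           i _ = K.refl
      evalYL-degreeBelow (r ∷ rs) (r<B ∷ rs<B) i B+L≤i with ℕ.m≤n⇒∃[o]m+o≡n (ℕ.m+n≤o⇒m≤o B B+L≤i)
      ... | m , ≡.refl = K.trans (coeff-evalYL-+B r rs r<B m)
        (evalYL-degreeBelow rs rs<B m (ℕ.+-cancelˡ-≤ B _ _ B+L≤i))

      evalYL-injective : ∀ rs → All (DegreeBelow B) rs → evalYL (θ ^P B) rs ≃ 0P → poly rs ≃ 0P
      evalYL-injective []       []           _   = Univariate.refl 1
      evalYL-injective (r ∷ rs) (r<B ∷ rs<B) ev≃0 =
        Univariate.trans 1 (Univariate.∷-cong 1 r≃0 (evalYL-injective rs rs<B tail≃0)) (Univariate.shift-zero 1)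
        where
        r≃0 : r ≃ 0P
        r≃0 = coeff-ext r 0P λ i → digit i (i ℕ.<? B)
          where
          digit : ∀ i → Dec (i < B) → coeff r i ≃ 0P
          digit i (yes i<B) = K.trans (K.sym (coeff-evalYL-<B r rs i<B)) (coeff-cong ev≃0 i)
          digit i (no i≮B)  = r<B i (ℕ.≮⇒≥ i≮B)
        tail≃0 : evalYL (θ ^P B) rs ≃ 0P
        tail≃0 = coeff-ext _ 0P λ m → K.trans (K.sym (coeff-evalYL-+B r rs r<B m)) (coeff-cong ev≃0 (B + m))

      evalYL-θ^B-divisible⇒zero : ∀ {N} → 2 ≤ B * N → ∀ rs → length rs ≤ N → All (DegreeBelow B) rs →
                                  (θ ^P (B * N) -P θ) ∣ evalYL (θ ^P B) rs → poly rs ≃ 0P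
      evalYL-θ^B-divisible⇒zero {N} 2≤BN rs rs≤N rs<B (z , ev≃Cz) =
        evalYL-injective rs rs<B (A.trans ev≃Cz (A.trans (A.*-congˡ z≃0) (A.zeroʳ _)))
        where
        ev<BN : DegreeBelow (B * N) (evalYL (θ ^P B) rs)
        ev<BN = degreeBelow-mono {p = evalYL (θ ^P B) rs}
          (ℕ.≤-trans (ℕ.*-monoˡ-≤ B rs≤N) (ℕ.≤-reflexive (ℕ.*-comm N B))) (evalYL-degreeBelow rs rs<B)
        z≃0 : z ≃ 0P
        z≃0 = θ^K-θ-multiple-degree<K⇒zero 2≤BN z (degreeBelow-cong ev≃Cz ev<BN)

  Y^N-θ∣ : ∀ {N} → 1 ≤ N → ∀ (U : Poly 2) →
           (∀ L → Σ ℕ λ B → L ≤ B × (θ ^P (B * N) -P θ) ∣ evalY (θ ^P B) U) →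
           (Y ^P N -P const θ) ∣ U
  Y^N-θ∣ {N} 1≤N U unbounded = quotient , (begin
    U                                ≈⟨ equation ⟩
    E *P quotient +P poly remainder  ≈⟨ +-cong refl remainder≃0 ⟩
    E *P quotient +P 0P              ≈⟨ +-identityʳ (E *P quotient) ⟩
    E *P quotient                    ∎)
    where
    open Univariate 1
    open Division N 1≤N θ
    open DivisionWithRemainder (divide U)
    open SetoidReasoning setoid
    module A = CommutativeRing (PolyRing 1)

    L = proj₁ (Univariate.commonDegreeBound 0 remainder)
    B = proj₁ (unbounded (2 + L))
    2+L≤B = proj₁ (proj₂ (unbounded (2 + L)))
    C∣U[θ^B] = proj₂ (proj₂ (unbounded (2 + L)))
    open Evaluation (θ ^P B) using (evalY-cong; evalY-+; evalY-*)
    open ThetaAdic.Digits B using (evalY-Y^N-θ; evalYL-θ^B-divisible⇒zero)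

    U[θ^B]≃ : evalY (θ ^P B) U ≃ (θ ^P (B * N) -P θ) *P evalY (θ ^P B) quotient +P evalYL (θ ^P B) remainder
    U[θ^B]≃ = A.trans (evalY-cong equation) (A.trans (evalY-+ (E *P quotient) (poly remainder))
      (A.+-congʳ (A.trans (evalY-* E quotient) (A.*-congʳ (evalY-Y^N-θ N)))))

    remainder≃0 : poly remainder ≃ 0P
    remainder≃0 = evalYL-θ^B-divisible⇒zero (ℕ.*-mono-≤ (ℕ.m+n≤o⇒m≤o 2 2+L≤B) 1≤N) remainder remainder-length
      (proj₂ (Univariate.commonDegreeBound 0 remainder) (ℕ.m+n≤o⇒n≤o 2 2+L≤B))
      (∣-remainder C∣U[θ^B] U[θ^B]≃)

  substY-0P : ∀ s (a : Poly 1) → substY s a 0P ≡ 0P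
  substY-0P zero    a = ≡.refl
  substY-0P (suc s) a = ≡.refl

  module _ (q M : ℕ) (1<q : 1 < q) where
    DivisibleAtPowers : ∀ s → Poly (s + 2) → Set (c ⊔ ℓ)
    DivisibleAtPowers s U = Σ ℕ λ D → ∀ d → D ≤ d →
      lift s (θ ^P (q ^ (d + M)) -P θ) ∣ substY s (θ ^P (q ^ d)) U

    unboundedly-divisible : ∀ U → DivisibleAtPowers 0 U →
      ∀ L → Σ ℕ λ B → L ≤ B × (θ ^P (B * q ^ M) -P θ) ∣ evalY (θ ^P B) U
    unboundedly-divisible U (D , divisible) L = q ^ d , L≤q^d ,
      ≡.subst (λ K → (θ ^P K -P θ) ∣ evalY (θ ^P (q ^ d)) U) (ℕ.^-distribˡ-+-* q d M) (divisible d (ℕ.m≤m+n D L))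
      where
      d = D + L
      L≤q^d = ℕ.≤-trans (ℕ.m≤n+m L D) (ℕ.<⇒≤ (n<q^n 1<q d))

    coefficientwise : ∀ s Us → DivisibleAtPowers (suc s) (poly Us) → All (DivisibleAtPowers s) Us
    coefficientwise s Us (D , divisible) = All-by-coeff Us λ i → D , λ d D≤d →
      ≡.subst (lift s (θ ^P (q ^ (d + M)) -P θ) ∣_) (coeff-map (substY s (θ ^P (q ^ d))) (substY-0P s _) Us i)
        (Univariate.const-∣⇒∣-coeff (s + 1) (divisible d D≤d) i)

    divisibleAtPowers⇒divisible : ∀ s U → DivisibleAtPowers s U → lift s (Y ^P (q ^ M) -P const θ) ∣ U
    divisibleAtPowers⇒divisible zero    U        h =
      Y^N-θ∣ (ℕ.≤-trans (s≤s z≤n) (n<q^n 1<q M)) U (unboundedly-divisible U h)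
    divisibleAtPowers⇒divisible (suc s) (poly Us) h =
      Univariate.All-∣⇒const-∣ (s + 2) (All.map (λ {U} → divisibleAtPowers⇒divisible s U) (coefficientwise s Us h))

order>1 : ∀ {c ℓ q} → FiniteField c ℓ q → 1 < q
order>1 {q = zero}          𝔽 = ⊥-elim (¬Fin0 (Inverse.from (FiniteField.enumeration 𝔽) (FiniteField.0# 𝔽)))
order>1 {q = suc zero}      𝔽 = ⊥-elim (1≉0 (trans (sym (inverseˡ (unique (from 0#) (from 1#)))) (inverseˡ ≡.refl)))
  where
  open FiniteField 𝔽
  open Inverse enumeration
  unique : (i j : Fin 1) → i ≡ j
  unique Fin.zero Fin.zero = ≡.refl
order>1 {q = suc (suc q)} 𝔽 = s≤s (s≤s z≤n)

lemma2 : ∀ {c ℓ} (q : ℕ) (𝔽 : FiniteField c ℓ q) →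
             let open PolyOps (FiniteField.field′ 𝔽) in
             (s : ℕ) (U : Poly (s + 2)) (M : ℕ) →
             (Σ ℕ λ D → (d : ℕ) → D ≤ d →
                Σ (Poly (s + 1)) λ W →
                  substY s (θ ^P (q ^ d)) U ≈P lift s ((θ ^P (q ^ (d + M))) -P θ) *P W) →
             Σ (Poly (s + 2)) λ V →
               U ≈P lift s ((Y ^P (q ^ M)) -P const θ) *P V
lemma2 q 𝔽 s U M (D , divisible) = map₂ unwrap
  (divisibleAtPowers⇒divisible F q M (order>1 𝔽) s U (D , λ d D≤d → map₂ ⟨_⟩ (divisible d D≤d)))
  where F = FiniteField.field′ 𝔽
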